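{- For every integer $n\ge 3$, the oriented diameter of $Pow(\mathbb{Z}_n)$ is at most $3$, where $\mathbb{Z}_n$ is the cyclic group of order $n$.
   Context: For a finite group $G$, the power graph $Pow(G)$ is the simple undirected graph with vertex set $G$ in which two distinct elements $x,y$ are adjacent if and only if one of them is an integer power of the other. An orientation of an undirected graph $X$ assigns exactly one direction to each edge of $X$. For a directed graph $D$, $d_D(u,v)$ is the length of a shortest directed path from $u$ to $v$ ($\infty$ if none exists), and $diam(D)=\max_{u,v} d_D(u,v)$. The oriented diameter $OD(X)$ of $X$ is the minimum of $diam(D)$ over all directed graphs $D$ obtained from $X$ by an orientation. -}

module Defs where

open import Data.Nat using (ℕ; zero; suc; _*_; _≤_; NonZero)
open import Data.Nat.DivMod using (_%_)
open import Data.Fin using (Fin; toℕ)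
open import Data.Bool using (Bool; true)
open import Data.Product using (Σ; ∃; _×_)
open import Data.Sum using (_⊎_)
open import Relation.Nullary using (¬_)
open import Relation.Binary.PropositionalEquality using (_≡_; _≢_)

-- The cyclic group ℤ_n, written additively, with carrier Fin n
-- (element i ↔ residue i mod n).  In additive notation the k-th power
-- of x is k·x = (k * x) mod n.

-- y is an integer power of x in ℤ_n, i.e. y = k·x for some k.
-- (Since x has finite order, every integer power x^k with k ∈ ℤ equals
-- x^k' for some natural k'; so quantifying over ℕ is the same.)
IsPowerOf : (n : ℕ) .{{_ : NonZero n}} → Fin n → Fin n → Set
IsPowerOf n y x = ∃ λ (k : ℕ) → toℕ y ≡ (k * toℕ x) % n

PowAdj : (n : ℕ) .{{_ : NonZero n}} → Fin n → Fin n → Set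
PowAdj n x y = x ≢ y × (IsPowerOf n y x ⊎ IsPowerOf n x y)

record IsOrientation {V : Set} (Adj : V → V → Set) (arc : V → V → Bool) : Set where
  field
    arc⇒adj  : ∀ u v → arc u v ≡ true → Adj u v
    adj⇒arc  : ∀ u v → Adj u v → arc u v ≡ true ⊎ arc v u ≡ true
    oneDir   : ∀ u v → arc u v ≡ true → ¬ (arc v u ≡ true)

-- DPath arc k u v : there is a directed path (walk) from u to v of
-- length at most k in the digraph with arc relation `arc`;
-- equivalently d_D(u,v) ≤ k.
data DPath {V : Set} (arc : V → V → Bool) : ℕ → V → V → Set where
  here  : ∀ {k u} → DPath arc k u u
  step  : ∀ {k u w v} → arc u w ≡ true → DPath arc k w v → DPath arc (suc k) u v

DiamAtMost : {V : Set} → (V → V → Bool) → ℕ → Set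
DiamAtMost {V} arc d = ∀ (u v : V) → DPath arc d u v

OrientedDiamAtMost : {V : Set} → (V → V → Set) → ℕ → Set
OrientedDiamAtMost {V} Adj d =
  Σ (V → V → Bool) λ arc → IsOrientation Adj arc × DiamAtMost arc d

{-# OPTIONS --safe #-}
module Submission where

-- The identity 0 and the generator 1 of ℤ_n are adjacent to every other
-- vertex of Pow(ℤ_n).  Orient 1 → 0, and 0 → v → 1 for every other vertex v,
-- so that each such v lies on the directed triangle 0 → v → 1 → 0; the
-- remaining edges may be oriented arbitrarily.  Then u → 1 → 0 → v joins any
-- two vertices in at most three steps, and 0 → 2 → 1 is where n ≥ 3 is needed.

open import Defs
open import Data.Nat as ℕ using (ℕ; _+_; _*_; _≤_; NonZero; s≤s; z≤n)
open import Data.Nat.Properties using (*-identityʳ)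
open import Data.Nat.DivMod using (_%_; m%n<n; m%n%n≡m%n; m<n⇒m%n≡m; %-distribˡ-*)
open import Data.Fin using (Fin; suc; toℕ; fromℕ<)
open import Data.Fin.Patterns using (0F; 1F; 2F)
open import Data.Fin.Properties using (_≟_; _<?_; <-cmp; <-asym; any?; toℕ<n; toℕ-fromℕ<)
open import Data.Bool using (Bool; true; false)
open import Data.Product using (∃; _,_; proj₁; proj₂)
open import Data.Sum using (_⊎_; inj₁; inj₂; swap)
open import Data.Empty using (⊥-elim)
open import Relation.Nullary using (¬_; Dec; yes; does; ¬?; _×-dec_; _⊎-dec_)
open import Relation.Nullary.Decidable using (dec-true; map′)
open import Relation.Binary using (Decidable; Symmetric; tri<; tri≈; tri>)
open import Relation.Binary.PropositionalEquality
  using (_≡_; _≢_; refl; sym; cong; ≢-sym; module ≡-Reasoning)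

witness : {A : Set} (a? : Dec A) → does a? ≡ true → A
witness (yes a) _ = a

module _ {m : ℕ} {Adj : Fin (3 + m) → Fin (3 + m) → Set}
         (Adj? : Decidable Adj) (Adj-sym : Symmetric Adj) (Adj-irrefl : ∀ {v} → ¬ Adj v v)
         (0F-dominating : ∀ v → v ≢ 0F → Adj 0F v)
         (1F-dominating : ∀ v → v ≢ 1F → Adj 1F v) where

  triangleArc : Fin (3 + m) → Fin (3 + m) → Bool
  triangleArc 0F            0F            = false
  triangleArc 0F            1F            = false
  triangleArc 0F            (suc (suc _)) = true
  triangleArc 1F            0F            = true
  triangleArc 1F            (suc _)       = false
  triangleArc (suc (suc _)) 0F            = false
  triangleArc (suc (suc _)) 1F            = true
  triangleArc u@(suc (suc _)) v@(suc (suc _)) = does (u <? v ×-dec Adj? u v)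

  triangleArc⇒adj : ∀ u v → triangleArc u v ≡ true → Adj u v
  triangleArc⇒adj 0F            0F            ()
  triangleArc⇒adj 0F            1F            ()
  triangleArc⇒adj 0F            (suc (suc _)) _ = 0F-dominating _ (λ ())
  triangleArc⇒adj 1F            0F            _ = 1F-dominating 0F (λ ())
  triangleArc⇒adj 1F            (suc _)       ()
  triangleArc⇒adj (suc (suc _)) 0F            ()
  triangleArc⇒adj (suc (suc _)) 1F            _ = Adj-sym (1F-dominating _ (λ ()))
  triangleArc⇒adj u@(suc (suc _)) v@(suc (suc _)) e =
    proj₂ (witness (u <? v ×-dec Adj? u v) e)

  adj⇒triangleArc : ∀ u v → Adj u v → triangleArc u v ≡ true ⊎ triangleArc v u ≡ true
  adj⇒triangleArc 0F            0F            adj = ⊥-elim (Adj-irrefl adj)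
  adj⇒triangleArc 0F            1F            _   = inj₂ refl
  adj⇒triangleArc 0F            (suc (suc _)) _   = inj₁ refl
  adj⇒triangleArc 1F            0F            _   = inj₁ refl
  adj⇒triangleArc 1F            1F            adj = ⊥-elim (Adj-irrefl adj)
  adj⇒triangleArc 1F            (suc (suc _)) _   = inj₂ refl
  adj⇒triangleArc (suc (suc _)) 0F            _   = inj₂ refl
  adj⇒triangleArc (suc (suc _)) 1F            _   = inj₁ refl
  adj⇒triangleArc u@(suc (suc _)) v@(suc (suc _)) adj with <-cmp u v
  ... | tri< u<v _ _ = inj₁ (dec-true (u <? v ×-dec Adj? u v) (u<v , adj))
  ... | tri≈ _ refl _ = ⊥-elim (Adj-irrefl adj)
  ... | tri> _ _ v<u = inj₂ (dec-true (v <? u ×-dec Adj? v u) (v<u , Adj-sym adj))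

  triangleArc-asym : ∀ u v → triangleArc u v ≡ true → ¬ (triangleArc v u ≡ true)
  triangleArc-asym 0F            0F            ()
  triangleArc-asym 0F            1F            ()
  triangleArc-asym 0F            (suc (suc _)) _ ()
  triangleArc-asym 1F            0F            _ ()
  triangleArc-asym 1F            (suc _)       ()
  triangleArc-asym (suc (suc _)) 0F            ()
  triangleArc-asym (suc (suc _)) 1F            _ ()
  triangleArc-asym u@(suc (suc _)) v@(suc (suc _)) e e′ =
    <-asym (proj₁ (witness (u <? v ×-dec Adj? u v) e))
           (proj₁ (witness (v <? u ×-dec Adj? v u) e′))

  triangleArc-isOrientation : IsOrientation Adj triangleArc
  triangleArc-isOrientation = record
    { arc⇒adj = triangleArc⇒adj
    ; adj⇒arc = adj⇒triangleArc
    ; oneDir  = triangleArc-asym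
    }

  triangleArc-diam≤3 : DiamAtMost triangleArc 3
  triangleArc-diam≤3 0F            0F            = here
  triangleArc-diam≤3 0F            1F            = step {w = 2F} refl (step refl here)
  triangleArc-diam≤3 0F            (suc (suc _)) = step refl here
  triangleArc-diam≤3 1F            0F            = step refl here
  triangleArc-diam≤3 1F            1F            = here
  triangleArc-diam≤3 1F            (suc (suc _)) = step {w = 0F} refl (step refl here)
  triangleArc-diam≤3 (suc (suc _)) 0F            = step {w = 1F} refl (step refl here)
  triangleArc-diam≤3 (suc (suc _)) 1F            = step refl here
  triangleArc-diam≤3 (suc (suc _)) (suc (suc _)) =
    step {w = 1F} refl (step {w = 0F} refl (step refl here))

  twoDominating⇒orientedDiam≤3 : OrientedDiamAtMost Adj 3
  twoDominating⇒orientedDiam≤3 = triangleArc , triangleArc-isOrientation , triangleArc-diam≤3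

[m%n*o]%n≡[m*o]%n : ∀ m o n .{{_ : NonZero n}} → (m % n * o) % n ≡ (m * o) % n
[m%n*o]%n≡[m*o]%n m o n = begin
  (m % n * o) % n           ≡⟨ %-distribˡ-* (m % n) o n ⟩
  (m % n % n * (o % n)) % n ≡⟨ cong (λ i → (i * (o % n)) % n) (m%n%n≡m%n m n) ⟩
  (m % n * (o % n)) % n     ≡⟨ %-distribˡ-* m o n ⟨
  (m * o) % n               ∎
  where open ≡-Reasoning

isPowerOf? : ∀ n .{{_ : NonZero n}} (y x : Fin n) → Dec (IsPowerOf n y x)
isPowerOf? n y x =
  map′ (λ (k , e) → toℕ k , e) reduce (any? λ k → toℕ y ℕ.≟ (toℕ k * toℕ x) % n)
  where
  reduce : IsPowerOf n y x → ∃ λ (k : Fin n) → toℕ y ≡ (toℕ k * toℕ x) % n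
  reduce (k , e) = fromℕ< (m%n<n k n) , (begin
    toℕ y                                       ≡⟨ e ⟩
    (k * toℕ x) % n                             ≡⟨ [m%n*o]%n≡[m*o]%n k (toℕ x) n ⟨
    (k % n * toℕ x) % n                         ≡⟨ cong (λ i → (i * toℕ x) % n) (toℕ-fromℕ< (m%n<n k n)) ⟨
    (toℕ (fromℕ< (m%n<n k n)) * toℕ x) % n      ∎)
    where open ≡-Reasoning

isPowerOf-0F : ∀ {m} (x : Fin (1 + m)) → IsPowerOf (1 + m) 0F x
isPowerOf-0F x = 0 , refl

isPowerOf-1F : ∀ {m} (y : Fin (2 + m)) → IsPowerOf (2 + m) y 1F
isPowerOf-1F {m} y = toℕ y , sym (begin
  (toℕ y * 1) % (2 + m) ≡⟨ cong (_% (2 + m)) (*-identityʳ (toℕ y)) ⟩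
  toℕ y % (2 + m)       ≡⟨ m<n⇒m%n≡m (toℕ<n y) ⟩
  toℕ y                 ∎)
  where open ≡-Reasoning

powAdj? : ∀ n .{{_ : NonZero n}} → Decidable (PowAdj n)
powAdj? n x y = ¬? (x ≟ y) ×-dec (isPowerOf? n y x ⊎-dec isPowerOf? n x y)

powAdj-sym : ∀ {n} .{{_ : NonZero n}} → Symmetric (PowAdj n)
powAdj-sym (x≢y , p) = ≢-sym x≢y , swap p

powAdj-irrefl : ∀ {n} .{{_ : NonZero n}} {x : Fin n} → ¬ PowAdj n x x
powAdj-irrefl (x≢x , _) = x≢x refl

powAdj-0F : ∀ {m} (v : Fin (1 + m)) → v ≢ 0F → PowAdj (1 + m) 0F v
powAdj-0F v v≢0 = ≢-sym v≢0 , inj₂ (isPowerOf-0F v)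

powAdj-1F : ∀ {m} (v : Fin (2 + m)) → v ≢ 1F → PowAdj (2 + m) 1F v
powAdj-1F v v≢1 = ≢-sym v≢1 , inj₁ (isPowerOf-1F v)

mainTheorem7 : (n : ℕ) {{_ : NonZero n}} → 3 ≤ n → OrientedDiamAtMost (PowAdj n) 3
mainTheorem7 _ (s≤s (s≤s (s≤s (z≤n {m})))) =
  twoDominating⇒orientedDiam≤3
    (powAdj? (3 + m)) powAdj-sym powAdj-irrefl powAdj-0F powAdj-1F
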